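{- Let $x,y$ be binary strings, $\delta\ge 0$, and let $w'$ be a positive integer dividing $|x|$. If $\mathrm{LCS}(x,y)\ge(1-\delta)|x|$, then at most $\sqrt{\delta}\,\frac{|x|}{w'}$ intervals $I\in\mathcal{I}_{w'}$ satisfy $\mathrm{LCS}(x_I,y_{J^\tau_I})<(1-\sqrt{\delta})|I|$.
   Context: An interval $I=[a,b]$ denotes $\{a+1,\dots,b\}$, of length $b-a$, and $x_I=x_{a+1}\cdots x_b$. A $w'$-interval is an interval of length $w'$ whose endpoints are multiples of $w'$; $\mathcal{I}_{w'}$ is the set of $w'$-intervals contained in $[0,|x|]$. Fix a canonical matching $\tau$ between positions of $x$ and of $y$ realizing a longest common subsequence (e.g. the lexicographically earliest one). For an interval $I$ of positions of $x$, $J^\tau_I$ is the smallest interval such that all bits of $x_I$ matched by $\tau$ are matched to positions in $J^\tau_I$.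
   Formalization: The parameter δ ranges over the nonnegative rationals. -}

module Defs where

open import Data.Bool using (Bool; _∧_; if_then_else_)
open import Data.Bool.Properties using () renaming (_≟_ to _≟ᵇ_)
open import Data.Nat using (ℕ; zero; suc; _+_; _*_; _∸_; _≤_; _<_; _⊓_; _⊔_; _≤?_; _<?_)
open import Data.List using (List; []; _∷_; length; take; drop; map; filter; foldr; upTo)
open import Data.List.Relation.Unary.All using (All)
open import Data.List.Relation.Unary.Linked using (Linked)
open import Data.Maybe using (Maybe; just; nothing)
open import Data.Product using (_×_; _,_; proj₁; proj₂; ∃)
open import Relation.Nullary using (yes; no; does)
open import Relation.Nullary.Decidable using (_×-dec_)
open import Relation.Binary.PropositionalEquality using (_≡_)

BitString : Set
BitString = List Bool

lcs : BitString → BitString → ℕ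
lcs [] _ = 0
lcs (_ ∷ _) [] = 0
lcs (a ∷ xs) (b ∷ ys) =
  if does (a ≟ᵇ b) then suc (lcs xs ys) else (lcs xs (b ∷ ys) ⊔ lcs (a ∷ xs) ys)

at : BitString → ℕ → Maybe Bool
at [] _ = nothing
at (b ∷ _) zero = just b
at (_ ∷ s) (suc i) = at s i

-- x_{[a,b]} = x_{a+1} ... x_b  (1-indexed), i.e. 0-indexed positions a..b-1
sub : BitString → ℕ → ℕ → BitString
sub x a b = take (b ∸ a) (drop a x)

IsMatching : BitString → BitString → List (ℕ × ℕ) → Set
IsMatching x y τ =
  Linked (λ p q → proj₁ p < proj₁ q × proj₂ p < proj₂ q) τ ×
  All (λ p → ∃ λ c → at x (proj₁ p) ≡ just c × at y (proj₂ p) ≡ just c) τ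

IsLCSMatching : BitString → BitString → List (ℕ × ℕ) → Set
IsLCSMatching x y τ =
  IsMatching x y τ × (∀ σ → IsMatching x y σ → length σ ≤ length τ)

matchedIn : List (ℕ × ℕ) → ℕ → ℕ → List ℕ
matchedIn τ a b = map proj₂ (filter (λ p → (a ≤? proj₁ p) ×-dec (proj₁ p <? b)) τ)

-- y_{J^τ_I} for I = [a,b]: J^τ_I is the smallest interval containing all matched
-- y-positions (empty string if no bit of x_I is matched).
yJ : BitString → List (ℕ × ℕ) → ℕ → ℕ → BitString
yJ y τ a b with matchedIn τ a b
... | [] = []
... | j ∷ js = sub y (foldr _⊓_ j js) (suc (foldr _⊔_ j js))

-- Number of w'-intervals I_k = [k w', (k+1) w'] (k < m) that are "bad" for δ = p/q,
-- i.e. LCS(x_I, y_J) < (1 - √(p/q)) w', written exactly over ℕ as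
--   p · w'² < q · (w' - LCS(x_I, y_J))²     (note LCS(x_I,y_J) ≤ w').
badCount : BitString → BitString → List (ℕ × ℕ) → ℕ → ℕ → ℕ → ℕ → ℕ
badCount x y τ w p q m = length (filter bad? (upTo m))
  where
    L : ℕ → ℕ
    L k = lcs (sub x (k * w) (suc k * w)) (yJ y τ (k * w) (suc k * w))
    bad? = λ k → (p * w * w) <? (q * (w ∸ L k) * (w ∸ L k))

{-# OPTIONS --safe #-}
module Submission where

-- A longest-common-subsequence matching τ has exactly lcs x y pairs, and the pairs whose
-- x-position lies in the block I_k = [k w', (k+1) w'] form a common subsequence of x_{I_k}
-- and y_{J^τ_{I_k}}. Summing over the m blocks, Σ_k LCS(x_{I_k}, y_{J_k}) ≥ lcs x y ≥ (1-δ)|x|,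
-- so the deficits d_k = w' - LCS(x_{I_k}, y_{J_k}) total at most δ m w'. A bad block has
-- d_k > √δ w', hence by Markov's inequality there are at most √δ m of them; over ℕ the
-- square roots are avoided by squaring.

open import Defs
open import Data.Bool using (Bool; true; false)
open import Data.Bool.Properties using () renaming (_≟_ to _≟ᵇ_)
open import Data.Empty using (⊥-elim)
open import Data.List using (List; []; _∷_; [_]; _++_; length; map; filter; take; drop; foldr; upTo)
open import Data.List.Properties using (length-map; length-take; length-upTo; filter-accept)
open import Data.List.Membership.Propositional using (_∈_)
open import Data.List.Membership.Propositional.Properties using (∈-upTo⁺)
open import Data.List.Relation.Unary.All as All using (All; []; _∷_)
import Data.List.Relation.Unary.All.Properties as Allₚ
open import Data.List.Relation.Unary.Any using (here; there)
open import Data.List.Relation.Unary.Linked using (Linked; []; [-]; _∷_)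
import Data.List.Relation.Unary.Linked as Linked
import Data.List.Relation.Unary.Linked.Properties as Linkedₚ
open import Data.Maybe using (just)
open import Data.Nat using (ℕ; zero; suc; _+_; _*_; _∸_; _≤_; _<_; _⊓_; _⊔_; z≤n; s≤s; _≤?_; _<?_)
open import Data.Nat.ListAction using (sum)
open import Data.Nat.Properties
open import Data.Nat.Tactic.RingSolver using (solve-∀)
open import Data.Product using (_×_; _,_; proj₁; proj₂; ∃)
open import Data.Sum using (inj₁; inj₂)
open import Data.Unit using (⊤)
open import Level using (0ℓ)
open import Relation.Binary.PropositionalEquality
  using (_≡_; refl; sym; trans; cong; cong₂; subst; subst₂; module ≡-Reasoning)
open import Relation.Nullary using (yes; no; ¬_)
open import Relation.Nullary.Decidable using (_×-dec_)
open import Relation.Unary using (Pred; Decidable)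

mutual
  lcs≤lcs-∷ˡ : ∀ a x y → lcs x y ≤ lcs (a ∷ x) y
  lcs≤lcs-∷ˡ a []      y       = z≤n
  lcs≤lcs-∷ˡ a (c ∷ x) []      = z≤n
  lcs≤lcs-∷ˡ a (c ∷ x) (b ∷ y) with a ≟ᵇ b
  ... | yes refl = lcs-∷ʳ≤1+lcs (c ∷ x) a y
  ... | no _     = m≤m⊔n _ _

  lcs-∷ʳ≤1+lcs : ∀ x b y → lcs x (b ∷ y) ≤ suc (lcs x y)
  lcs-∷ʳ≤1+lcs []      b y = z≤n
  lcs-∷ʳ≤1+lcs (a ∷ x) b y with a ≟ᵇ b
  ... | yes refl = s≤s (lcs≤lcs-∷ˡ a x y)
  ... | no _     = ⊔-lub (≤-trans (lcs-∷ʳ≤1+lcs x b y) (s≤s (lcs≤lcs-∷ˡ a x y))) (n≤1+n _)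

lcs-comm : ∀ x y → lcs x y ≡ lcs y x
lcs-comm []          []          = refl
lcs-comm []          (_ ∷ _)     = refl
lcs-comm (_ ∷ _)     []          = refl
lcs-comm (true ∷ x)  (true ∷ y)  = cong suc (lcs-comm x y)
lcs-comm (false ∷ x) (false ∷ y) = cong suc (lcs-comm x y)
lcs-comm (true ∷ x)  (false ∷ y) =
  trans (cong₂ _⊔_ (lcs-comm x (false ∷ y)) (lcs-comm (true ∷ x) y)) (⊔-comm (lcs (false ∷ y) x) _)
lcs-comm (false ∷ x) (true ∷ y)  =
  trans (cong₂ _⊔_ (lcs-comm x (true ∷ y)) (lcs-comm (false ∷ x) y)) (⊔-comm (lcs (true ∷ y) x) _)

lcs≤lcs-∷ʳ : ∀ x b y → lcs x y ≤ lcs x (b ∷ y)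
lcs≤lcs-∷ʳ x b y = subst₂ _≤_ (lcs-comm y x) (lcs-comm (b ∷ y) x) (lcs≤lcs-∷ˡ b y x)

lcs-∷∷ : ∀ a x y → lcs (a ∷ x) (a ∷ y) ≡ suc (lcs x y)
lcs-∷∷ true  x y = refl
lcs-∷∷ false x y = refl

lcs≤length : ∀ x y → lcs x y ≤ length x
lcs≤length []          y           = z≤n
lcs≤length (_ ∷ _)     []          = z≤n
lcs≤length (true ∷ x)  (true ∷ y)  = s≤s (lcs≤length x y)
lcs≤length (false ∷ x) (false ∷ y) = s≤s (lcs≤length x y)
lcs≤length (true ∷ x)  (false ∷ y) = ⊔-lub (m≤n⇒m≤1+n (lcs≤length x (false ∷ y))) (lcs≤length (true ∷ x) y)
lcs≤length (false ∷ x) (true ∷ y)  = ⊔-lub (m≤n⇒m≤1+n (lcs≤length x (true ∷ y))) (lcs≤length (false ∷ x) y)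

at-++ : ∀ (u s : BitString) i → at (u ++ s) (length u + i) ≡ at s i
at-++ []      s i = refl
at-++ (_ ∷ u) s i = at-++ u s i

at-drop : ∀ (s : BitString) a i → at (drop a s) i ≡ at s (a + i)
at-drop s       zero    i = refl
at-drop []      (suc a) i = refl
at-drop (_ ∷ s) (suc a) i = at-drop s a i

at-take : ∀ (s : BitString) {n i} → i < n → at (take n s) i ≡ at s i
at-take []      {suc n} {i}     _         = refl
at-take (_ ∷ s) {suc n} {zero}  _         = refl
at-take (_ ∷ s) {suc n} {suc i} (s≤s i<n) = at-take s i<n

at-drop-∸ : ∀ (s : BitString) {a i} → a ≤ i → at (drop a s) (i ∸ a) ≡ at s i
at-drop-∸ s {a} {i} a≤i = trans (at-drop s a (i ∸ a)) (cong (at s) (m+[n∸m]≡n a≤i))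

at-sub : ∀ (s : BitString) {a b i} → a ≤ i → i < b → at (sub s a b) (i ∸ a) ≡ at s i
at-sub s {a} a≤i i<b = trans (at-take (drop a s) (∸-monoˡ-< i<b a≤i)) (at-drop-∸ s a≤i)

at≡just⇒<length : ∀ (s : BitString) i {c} → at s i ≡ just c → i < length s
at≡just⇒<length (_ ∷ s) zero    _ = s≤s z≤n
at≡just⇒<length (_ ∷ s) (suc i) e = s≤s (at≡just⇒<length s i e)

length-sub≤ : ∀ (s : BitString) a b → length (sub s a b) ≤ b ∸ a
length-sub≤ s a b = ≤-trans (≤-reflexive (length-take (b ∸ a) (drop a s))) (m⊓n≤m _ _)

_≺_ : ℕ × ℕ → ℕ × ℕ → Set
p ≺ q = proj₁ p < proj₁ q × proj₂ p < proj₂ q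

≺-trans : ∀ {p q r} → p ≺ q → q ≺ r → p ≺ r
≺-trans (i<i′ , j<j′) (i′<i″ , j′<j″) = <-trans i<i′ i′<i″ , <-trans j<j′ j′<j″

Agrees : BitString → BitString → ℕ × ℕ → Set
Agrees x y p = ∃ λ c → at x (proj₁ p) ≡ just c × at y (proj₂ p) ≡ just c

_≼_ : ℕ × ℕ → ℕ × ℕ → Set
p ≼ q = proj₁ p ≤ proj₁ q × proj₂ p ≤ proj₂ q

≼-trans : ∀ {p q r} → p ≼ q → q ≼ r → p ≼ r
≼-trans (i≤i′ , j≤j′) (i′≤i″ , j′≤j″) = ≤-trans i≤i′ i′≤i″ , ≤-trans j≤j′ j′≤j″

linked-∷⁺ : ∀ {v σ} → All (v ≺_) σ → Linked _≺_ σ → Linked _≺_ (v ∷ σ)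
linked-∷⁺ []      []  = [-]
linked-∷⁺ (r ∷ _) inc = r ∷ inc

linked-∷⇒head≺ : ∀ {p σ} → Linked _≺_ (p ∷ σ) → All (p ≺_) σ
linked-∷⇒head≺ [-]     = []
linked-∷⇒head≺ (r ∷ l) = Linkedₚ.Linked⇒All ≺-trans r l

linked-∷⇒head≼ : ∀ {p σ} → Linked _≺_ (p ∷ σ) → All (p ≼_) (p ∷ σ)
linked-∷⇒head≼ inc = (≤-refl , ≤-refl) ∷ All.map (λ (i<i′ , j<j′) → <⇒≤ i<i′ , <⇒≤ j<j′) (linked-∷⇒head≺ inc)

matching-map : ∀ {σ} x y x′ y′ {P : Pred (ℕ × ℕ) 0ℓ} (f : ℕ × ℕ → ℕ × ℕ) →
  (∀ {u v} → P u → P v → u ≺ v → f u ≺ f v) →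
  (∀ {u} → P u → Agrees x y u → Agrees x′ y′ (f u)) →
  All P σ → IsMatching x y σ → IsMatching x′ y′ (map f σ)
matching-map x y x′ y′ {P} f f-mono f-agrees Pσ (inc , agr) =
  linked Pσ inc , Allₚ.map⁺ (All.zipWith (λ (Pu , ag) → f-agrees Pu ag) (Pσ , agr))
  where
    linked : ∀ {σ} → All P σ → Linked _≺_ σ → Linked _≺_ (map f σ)
    linked []              []       = []
    linked (_ ∷ [])        [-]      = [-]
    linked (Pu ∷ Pv ∷ Pσ) (r ∷ rs) = f-mono Pu Pv r ∷ linked (Pv ∷ Pσ) rs

raise : ℕ → ℕ → ℕ × ℕ → ℕ × ℕ
raise a c p = a + proj₁ p , c + proj₂ p

lower : ℕ → ℕ → ℕ × ℕ → ℕ × ℕ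
lower a c p = proj₁ p ∸ a , proj₂ p ∸ c

matching-++ : ∀ {σ} (u v x y : BitString) → IsMatching x y σ →
  IsMatching (u ++ x) (v ++ y) (map (raise (length u) (length v)) σ)
matching-++ u v x y = matching-map x y (u ++ x) (v ++ y) {λ _ → ⊤} _
  (λ _ _ (i<i′ , j<j′) → +-monoʳ-< (length u) i<i′ , +-monoʳ-< (length v) j<j′)
  (λ {p} _ (c , eˣ , eʸ) → c , trans (at-++ u x (proj₁ p)) eˣ , trans (at-++ v y (proj₂ p)) eʸ)
  (All.universal _ _)

matching-drop : ∀ {σ} x y a c → All ((a , c) ≼_) σ → IsMatching x y σ →
  IsMatching (drop a x) (drop c y) (map (lower a c) σ)
matching-drop x y a c = matching-map x y (drop a x) (drop c y) (lower a c)
  (λ (a≤i , c≤j) _ (i<i′ , j<j′) → ∸-monoˡ-< i<i′ a≤i , ∸-monoˡ-< j<j′ c≤j)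
  (λ (a≤i , c≤j) (ch , eˣ , eʸ) → ch , trans (at-drop-∸ x a≤i) eˣ , trans (at-drop-∸ y c≤j) eʸ)

InBox : ℕ → ℕ → ℕ → ℕ → Pred (ℕ × ℕ) 0ℓ
InBox a b c d p = (a ≤ proj₁ p × proj₁ p < b) × (c ≤ proj₂ p × proj₂ p < d)

matching-sub : ∀ {σ} x y a b c d → All (InBox a b c d) σ → IsMatching x y σ →
  IsMatching (sub x a b) (sub y c d) (map (lower a c) σ)
matching-sub x y a b c d = matching-map x y (sub x a b) (sub y c d) (lower a c)
  (λ ((a≤i , _) , (c≤j , _)) _ (i<i′ , j<j′) → ∸-monoˡ-< i<i′ a≤i , ∸-monoˡ-< j<j′ c≤j)
  (λ ((a≤i , i<b) , (c≤j , j<d)) (ch , eˣ , eʸ) →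
     ch , trans (at-sub x a≤i i<b) eˣ , trans (at-sub y c≤j j<d) eʸ)

length≤lcs : ∀ x y σ → IsMatching x y σ → length σ ≤ lcs x y
length≤lcs x       y       []      _                           = z≤n
length≤lcs []      y       (_ ∷ _) (_ , (_ , () , _) ∷ _)
length≤lcs (_ ∷ _) []      (_ ∷ _) (_ , (_ , _ , ()) ∷ _)
length≤lcs (a ∷ x) (b ∷ y) σ@((suc _ , _) ∷ _) m@(inc , _) =
  ≤-trans (subst (_≤ lcs x (b ∷ y)) (length-map (lower 1 0) σ)
                 (length≤lcs x (b ∷ y) _ (matching-drop (a ∷ x) (b ∷ y) 1 0 above m)))
          (lcs≤lcs-∷ˡ a x (b ∷ y))
  where
    above : All ((1 , 0) ≼_) σ
    above = All.map (≼-trans (s≤s z≤n , z≤n)) (linked-∷⇒head≼ inc)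
length≤lcs (a ∷ x) (b ∷ y) σ@((zero , suc _) ∷ _) m@(inc , _) =
  ≤-trans (subst (_≤ lcs (a ∷ x) y) (length-map (lower 0 1) σ)
                 (length≤lcs (a ∷ x) y _ (matching-drop (a ∷ x) (b ∷ y) 0 1 above m)))
          (lcs≤lcs-∷ʳ (a ∷ x) b y)
  where
    above : All ((0 , 1) ≼_) σ
    above = All.map (≼-trans (z≤n , s≤s z≤n)) (linked-∷⇒head≼ inc)
length≤lcs (a ∷ x) (.a ∷ y) ((zero , zero) ∷ σ) (inc , (_ , refl , refl) ∷ agr) =
  subst (suc (length σ) ≤_) (sym (lcs-∷∷ a x y))
    (s≤s (subst (_≤ lcs x y) (length-map (lower 1 1) σ)
      (length≤lcs x y _ (matching-drop (a ∷ x) (a ∷ y) 1 1 (linked-∷⇒head≺ inc) (Linked.tail inc , agr)))))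

HasMatching : BitString → BitString → ℕ → Set
HasMatching x y n = ∃ λ σ → IsMatching x y σ × length σ ≡ n

hasMatching-++ : ∀ {n} (u v x y : BitString) → HasMatching x y n → HasMatching (u ++ x) (v ++ y) n
hasMatching-++ u v x y (σ , m , |σ|≡n) = _ , matching-++ u v x y m , trans (length-map _ σ) |σ|≡n

matching-∷∷ : ∀ {σ} a x y → IsMatching x y σ →
  IsMatching (a ∷ x) (a ∷ y) ((0 , 0) ∷ map (raise 1 1) σ)
matching-∷∷ {σ} a x y m with matching-++ [ a ] [ a ] x y m
... | inc , agr =
  linked-∷⁺ (Allₚ.map⁺ (All.universal (λ _ → s≤s z≤n , s≤s z≤n) σ)) inc , (a , refl , refl) ∷ agr

hasMatching-∷∷ : ∀ {n} a x y → HasMatching x y n → HasMatching (a ∷ x) (a ∷ y) (suc n)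
hasMatching-∷∷ a x y (σ , m , |σ|≡n) = _ , matching-∷∷ a x y m , cong suc (trans (length-map _ σ) |σ|≡n)

⊔-elim : ∀ (P : ℕ → Set) {m n} → P m → P n → P (m ⊔ n)
⊔-elim P {m} {n} pm pn with ⊔-sel m n
... | inj₁ m⊔n≡m = subst P (sym m⊔n≡m) pm
... | inj₂ m⊔n≡n = subst P (sym m⊔n≡n) pn

hasMatching-⊔ : ∀ {m n} a b x y → HasMatching x (b ∷ y) m → HasMatching (a ∷ x) y n →
  HasMatching (a ∷ x) (b ∷ y) (m ⊔ n)
hasMatching-⊔ a b x y hm hn =
  ⊔-elim (HasMatching (a ∷ x) (b ∷ y)) (hasMatching-++ [ a ] [] x (b ∷ y) hm) (hasMatching-++ [] [ b ] (a ∷ x) y hn)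

hasMatching-lcs : ∀ x y → HasMatching x y (lcs x y)
hasMatching-lcs []          y           = [] , ([] , []) , refl
hasMatching-lcs (_ ∷ _)     []          = [] , ([] , []) , refl
hasMatching-lcs (true ∷ x)  (true ∷ y)  = hasMatching-∷∷ true x y (hasMatching-lcs x y)
hasMatching-lcs (false ∷ x) (false ∷ y) = hasMatching-∷∷ false x y (hasMatching-lcs x y)
hasMatching-lcs (true ∷ x)  (false ∷ y) =
  hasMatching-⊔ true false x y (hasMatching-lcs x (false ∷ y)) (hasMatching-lcs (true ∷ x) y)
hasMatching-lcs (false ∷ x) (true ∷ y)  =
  hasMatching-⊔ false true x y (hasMatching-lcs x (true ∷ y)) (hasMatching-lcs (false ∷ x) y)

length-LCSMatching : ∀ x y {τ} → IsLCSMatching x y τ → length τ ≡ lcs x y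
length-LCSMatching x y {τ} (m , maximal) with hasMatching-lcs x y
... | σ , mσ , |σ|≡lcs = ≤-antisym (length≤lcs x y τ m) (subst (_≤ length τ) |σ|≡lcs (maximal σ mσ))

module _ {A : Set} {P : Pred A 0ℓ} (P? : Decidable P) where

  length-filter≤length-filter-∷ : ∀ u σ → length (filter P? σ) ≤ length (filter P? (u ∷ σ))
  length-filter≤length-filter-∷ u σ with P? u
  ... | yes _ = n≤1+n _
  ... | no _  = ≤-refl

  sum-map-filter≤ : ∀ f K → sum (map f (filter P? K)) ≤ sum (map f K)
  sum-map-filter≤ f []      = z≤n
  sum-map-filter≤ f (k ∷ K) with P? k
  ... | yes _ = +-monoʳ-≤ (f k) (sum-map-filter≤ f K)
  ... | no _  = ≤-trans (sum-map-filter≤ f K) (m≤n+m _ (f k))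

  length-filter*≤sum-map-filter : ∀ c f K → (∀ k → P k → c ≤ f k) →
    length (filter P? K) * c ≤ sum (map f (filter P? K))
  length-filter*≤sum-map-filter c f []      c≤f = z≤n
  length-filter*≤sum-map-filter c f (k ∷ K) c≤f with P? k
  ... | yes Pk = +-mono-≤ (c≤f k Pk) (length-filter*≤sum-map-filter c f K c≤f)
  ... | no _   = length-filter*≤sum-map-filter c f K c≤f

module _ {A : Set} where

  sum-map-mono : ∀ {f g : A → ℕ} K → (∀ k → f k ≤ g k) → sum (map f K) ≤ sum (map g K)
  sum-map-mono []      f≤g = z≤n
  sum-map-mono (k ∷ K) f≤g = +-mono-≤ (f≤g k) (sum-map-mono K f≤g)

  sum-map-mono-< : ∀ {f g : A → ℕ} {k} K → k ∈ K → (∀ k → f k ≤ g k) → f k < g k →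
    sum (map f K) < sum (map g K)
  sum-map-mono-< (_ ∷ K) (here refl) f≤g fk<gk = +-mono-<-≤ fk<gk (sum-map-mono K f≤g)
  sum-map-mono-< (j ∷ K) (there k∈K) f≤g fk<gk = +-mono-≤-< (f≤g j) (sum-map-mono-< K k∈K f≤g fk<gk)

  sum-map-* : ∀ c (f : A → ℕ) K → sum (map (λ k → c * f k) K) ≡ c * sum (map f K)
  sum-map-* c f []      = sym (*-zeroʳ c)
  sum-map-* c f (k ∷ K) = trans (cong (c * f k +_) (sum-map-* c f K)) (sym (*-distribˡ-+ c (f k) _))

  sum-map-∸+sum-map : ∀ w (f : A → ℕ) K → (∀ k → f k ≤ w) →
    sum (map (λ k → w ∸ f k) K) + sum (map f K) ≡ length K * w
  sum-map-∸+sum-map w f []      f≤w = refl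
  sum-map-∸+sum-map w f (k ∷ K) f≤w = begin
    (w ∸ f k + sum (map (λ k → w ∸ f k) K)) + (f k + sum (map f K))
      ≡⟨ interchange (w ∸ f k) _ (f k) _ ⟩
    (w ∸ f k + f k) + (sum (map (λ k → w ∸ f k) K) + sum (map f K))
      ≡⟨ cong₂ _+_ (m∸n+n≡m (f≤w k)) (sum-map-∸+sum-map w f K f≤w) ⟩
    w + length K * w ∎
    where
      open ≡-Reasoning
      interchange : ∀ a b c d → (a + b) + (c + d) ≡ (a + c) + (b + d)
      interchange = solve-∀

  length≤sum-length-filter : ∀ {B : Set} {P : A → Pred B 0ℓ} (P? : ∀ k → Decidable (P k)) K {σ} →
    All (λ u → ∃ λ k → k ∈ K × P k u) σ →
    length σ ≤ sum (map (λ k → length (filter (P? k) σ)) K)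
  length≤sum-length-filter P? K []                                        = z≤n
  length≤sum-length-filter P? K {u ∷ σ} ((k , k∈K , Pku) ∷ covered) =
    ≤-trans (s≤s (length≤sum-length-filter P? K covered))
      (sum-map-mono-< K k∈K (λ k → length-filter≤length-filter-∷ (P? k) u σ)
        (≤-reflexive (cong length (sym (filter-accept (P? k) Pku)))))

block-containing : ∀ w m {i} → i < m * w → ∃ λ k → k < m × k * w ≤ i × i < suc k * w
block-containing w (suc m) {i} i<[1+m]w with i <? m * w
... | yes i<mw with block-containing w m i<mw
...   | k , k<m , kw≤i , i<[1+k]w = k , m≤n⇒m≤1+n k<m , kw≤i , i<[1+k]w
block-containing w (suc m) {i} i<[1+m]w | no i≮mw = m , ≤-refl , ≮⇒≥ i≮mw , i<[1+m]w

foldr-⊓-≤ : ∀ j js → All (foldr _⊓_ j js ≤_) (j ∷ js)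
foldr-⊓-≤ j []       = ≤-refl ∷ []
foldr-⊓-≤ j (z ∷ zs) with foldr-⊓-≤ j zs
... | ≤j ∷ ≤zs = ≤-trans (m⊓n≤n z _) ≤j ∷ m⊓n≤m z _ ∷ All.map (≤-trans (m⊓n≤n z _)) ≤zs

≤-foldr-⊔ : ∀ j js → All (_≤ foldr _⊔_ j js) (j ∷ js)
≤-foldr-⊔ j []       = ≤-refl ∷ []
≤-foldr-⊔ j (z ∷ zs) with ≤-foldr-⊔ j zs
... | j≤ ∷ zs≤ = ≤-trans j≤ (m≤n⊔m z _) ∷ m≤m⊔n z _ ∷ All.map (λ z′≤ → ≤-trans z′≤ (m≤n⊔m z _)) zs≤

XIn : ℕ → ℕ → Pred (ℕ × ℕ) 0ℓ
XIn a b p = a ≤ proj₁ p × proj₁ p < b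

xIn? : ∀ a b → Decidable (XIn a b)
xIn? a b p = (a ≤? proj₁ p) ×-dec (proj₁ p <? b)

length-filter-xIn≤lcs-yJ : ∀ x y {τ} a b → IsMatching x y τ →
  length (filter (xIn? a b) τ) ≤ lcs (sub x a b) (yJ y τ a b)
length-filter-xIn≤lcs-yJ x y {τ} a b (inc , agr) with matchedIn τ a b in eq
... | [] = subst (_≤ lcs (sub x a b) []) (sym |σ|≡0) z≤n
  where
    |σ|≡0 : length (filter (xIn? a b) τ) ≡ 0
    |σ|≡0 = trans (sym (length-map proj₂ (filter (xIn? a b) τ))) (cong length eq)
... | j ∷ js = subst (_≤ lcs (sub x a b) (sub y lo (suc hi))) (length-map (lower a lo) σ)
    (length≤lcs (sub x a b) (sub y lo (suc hi)) _
      (matching-sub x y a b lo (suc hi) (All.zip (Allₚ.all-filter (xIn? a b) τ , yBounds))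
        (Linkedₚ.filter⁺ (xIn? a b) ≺-trans inc , Allₚ.filter⁺ (xIn? a b) agr)))
  where
    σ = filter (xIn? a b) τ
    lo = foldr _⊓_ j js
    hi = foldr _⊔_ j js
    yBounds : All (λ p → lo ≤ proj₂ p × proj₂ p < suc hi) σ
    yBounds = Allₚ.map⁻ (subst (All _) (sym eq) (All.zip (foldr-⊓-≤ j js , All.map s≤s (≤-foldr-⊔ j js))))

lcs≤sum-lcs-blocks : ∀ x y τ w m → length x ≤ m * w → IsLCSMatching x y τ →
  lcs x y ≤ sum (map (λ k → lcs (sub x (k * w) (suc k * w)) (yJ y τ (k * w) (suc k * w))) (upTo m))
lcs≤sum-lcs-blocks x y τ w m |x|≤mw τ-lcs@(mτ@(_ , agr) , _) =
  ≤-trans (≤-reflexive (sym (length-LCSMatching x y τ-lcs)))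
    (≤-trans (length≤sum-length-filter (λ k → xIn? (k * w) (suc k * w)) (upTo m) (All.map block agr))
      (sum-map-mono (upTo m) (λ k → length-filter-xIn≤lcs-yJ x y (k * w) (suc k * w) mτ)))
  where
    block : ∀ {p} → Agrees x y p → ∃ λ k → k ∈ upTo m × XIn (k * w) (suc k * w) p
    block {p} (_ , eˣ , _) with block-containing w m (<-≤-trans (at≡just⇒<length x (proj₁ p) eˣ) |x|≤mw)
    ... | k , k<m , kw≤i , i<[1+k]w = k , ∈-upTo⁺ k<m , kw≤i , i<[1+k]w

m*m<n*n⇒m<n : ∀ {m n} → m * m < n * n → m < n
m*m<n*n⇒m<n mm<nn = ≰⇒> (λ n≤m → <⇒≱ mm<nn (*-mono-≤ n≤m n≤m))

m*[1+n]≤m*n⇒m≡0 : ∀ m n → m * suc n ≤ m * n → m ≡ 0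
m*[1+n]≤m*n⇒m≡0 zero    n _  = refl
m*[1+n]≤m*n⇒m≡0 (suc m) n le = ⊥-elim (1+n≰n (*-cancelˡ-≤ (suc m) le))

geometric-mean-< : ∀ r s v t u z → r * s * s < t * u * u → r * v * v < t * z * z → r * s * v < t * u * z
geometric-mean-< r s v t u z rss<tuu rvv<tzz =
  m*m<n*n⇒m<n (subst₂ _<_ (regroup r s v) (regroup t u z) (*-mono-< rss<tuu rvv<tzz))
  where
    regroup : ∀ r s v → r * s * s * (r * v * v) ≡ r * s * v * (r * s * v)
    regroup = solve-∀

-- If p n² < q b², every large d k exceeds p n w / (q b), so the b large ones
-- alone already sum to more than p n w / q.
markov-count : ∀ p q w n (d : ℕ → ℕ) K → q * sum (map d K) ≤ p * n * w →
  let b = length (filter (λ k → p * w * w <? q * d k * d k) K) in q * b * b ≤ p * n * n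
markov-count p q w n d K qΣd≤pnw = ≮⇒≥ impossible
  where
    large? : Decidable (λ k → p * w * w < q * d k * d k)
    large? k = p * w * w <? q * d k * d k
    b = length (filter large? K)
    X = p * n * w

    impossible : ¬ (p * n * n < q * b * b)
    impossible pnn<qbb = n≮0 (subst (p * n * n <_) qbb≡0 pnn<qbb)
      where
        b[1+X]≤bX : b * suc X ≤ b * X
        b[1+X]≤bX = begin
          b * suc X
            ≤⟨ length-filter*≤sum-map-filter large? (suc X) _ K (λ k → geometric-mean-< p n w q b (d k) pnn<qbb) ⟩
          sum (map (λ k → q * b * d k) (filter large? K)) ≤⟨ sum-map-filter≤ large? _ K ⟩
          sum (map (λ k → q * b * d k) K)                 ≡⟨ sum-map-* (q * b) d K ⟩
          q * b * sum (map d K)                           ≡⟨ reassoc q b (sum (map d K)) ⟩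
          b * (q * sum (map d K))                         ≤⟨ *-monoʳ-≤ b qΣd≤pnw ⟩
          b * X                                           ∎
          where
            open ≤-Reasoning
            reassoc : ∀ r s t → r * s * t ≡ s * (r * t)
            reassoc = solve-∀
        qbb≡0 : q * b * b ≡ 0
        qbb≡0 rewrite m*[1+n]≤m*n⇒m≡0 b X b[1+X]≤bX = *-zeroʳ (q * 0)

deficit-bound : ∀ p q N ℓ D S → D + S ≡ N → ℓ ≤ S → q * N ≤ q * ℓ + p * N → q * D ≤ p * N
deficit-bound p q N ℓ D S D+S≡N ℓ≤S qN≤qℓ+pN = +-cancelʳ-≤ (q * S) (q * D) (p * N) (begin
  q * D + q * S  ≡⟨ *-distribˡ-+ q D S ⟨
  q * (D + S)    ≡⟨ cong (q *_) D+S≡N ⟩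
  q * N          ≤⟨ qN≤qℓ+pN ⟩
  q * ℓ + p * N  ≤⟨ +-monoˡ-≤ (p * N) (*-monoʳ-≤ q ℓ≤S) ⟩
  q * S + p * N  ≡⟨ +-comm (q * S) (p * N) ⟩
  p * N + q * S  ∎)
  where open ≤-Reasoning

lemma8 : (x y : List Bool) (τ : List (ℕ × ℕ)) (w m p q : ℕ) →
    0 < w → length x ≡ m * w → 0 < q →
    IsLCSMatching x y τ →
    q * length x ≤ q * lcs x y + p * length x →
    q * badCount x y τ w p q m * badCount x y τ w p q m ≤ p * m * m
lemma8 x y τ w m p q _ |x|≡mw _ τ-lcs δ-bound = markov-count p q w m deficit (upTo m) total-deficit
  where
    L : ℕ → ℕ
    L k = lcs (sub x (k * w) (suc k * w)) (yJ y τ (k * w) (suc k * w))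
    deficit : ℕ → ℕ
    deficit k = w ∸ L k
    L≤w : ∀ k → L k ≤ w
    L≤w k = ≤-trans (lcs≤length (sub x (k * w) (suc k * w)) _)
              (≤-trans (length-sub≤ x (k * w) (suc k * w)) (≤-reflexive (m+n∸n≡m w (k * w))))
    Σdeficit+ΣL≡mw : sum (map deficit (upTo m)) + sum (map L (upTo m)) ≡ m * w
    Σdeficit+ΣL≡mw = trans (sum-map-∸+sum-map w L (upTo m) L≤w) (cong (_* w) (length-upTo m))
    total-deficit : q * sum (map deficit (upTo m)) ≤ p * m * w
    total-deficit = subst (q * sum (map deficit (upTo m)) ≤_) (sym (*-assoc p m w))
      (deficit-bound p q (m * w) (lcs x y) _ _ Σdeficit+ΣL≡mw
        (lcs≤sum-lcs-blocks x y τ w m (≤-reflexive |x|≡mw) τ-lcs)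
        (subst (λ n → q * n ≤ q * lcs x y + p * n) |x|≡mw δ-bound))
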